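{- For all positive integers $N_1,N_2,q,r$, we have $f_{q,r}(N_1)\,f_{q,r}(N_2)\geq f_{q,r}(N_1N_2)$.
   Context: For a $q$-edge-colored complete graph $K$ with a linear order on its vertices, $f_{q,r}(K)$ is the maximum number of vertices of a monotone path (vertices increasing in traversal order) in $K$ whose edges use at most $r$ colors; $f_{q,r}(N)$ is the minimum of $f_{q,r}(K)$ over all such $K$ on $N$ vertices. -}

module Defs where

open import Data.Nat using (ℕ; zero; suc; _≤_; _<_; _*_)
open import Data.Fin using (Fin)
import Data.Fin as F
open import Data.List using (List; []; _∷_; length)
open import Data.List.Relation.Unary.All using (All)
open import Data.List.Relation.Unary.Linked using (Linked)
open import Data.List.Membership.Propositional using (_∈_)
open import Data.Product using (Σ; ∃; _×_)

-- A q-edge-coloring of the complete graph on the linearly ordered vertex set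
-- Fin N (ordered by the usual order on Fin).  The colour of the edge {i,j}
-- with i < j is  c i j ; values with i ≥ j are never consulted.
Coloring : ℕ → ℕ → Set
Coloring N q = Fin N → Fin N → Fin q

edgeColors : ∀ {N q} → Coloring N q → List (Fin N) → List (Fin q)
edgeColors c []            = []
edgeColors c (x ∷ [])      = []
edgeColors c (x ∷ y ∷ xs)  = c x y ∷ edgeColors c (y ∷ xs)

Monotone : ∀ {N} → List (Fin N) → Set
Monotone = Linked F._<_

AtMostColors : ∀ {q} → ℕ → List (Fin q) → Set
AtMostColors {q} r cs = Σ (List (Fin q)) λ S → length S ≤ r × All (_∈ S) cs

HasPath : ∀ {N q} → Coloring N q → ℕ → ℕ → Set
HasPath {N} c r k =
  Σ (List (Fin N)) λ P → length P ≡' k × Monotone P × AtMostColors r (edgeColors c P)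
  where
  open import Relation.Binary.PropositionalEquality using () renaming (_≡_ to _≡'_)

-- m = f_{q,r}(K): maximum number of vertices of such a path
IsFK : ∀ {N q} → Coloring N q → ℕ → ℕ → Set
IsFK c r m = HasPath c r m × (∀ k → HasPath c r k → k ≤ m)

-- m = f_{q,r}(N): minimum of f_{q,r}(K) over all q-colourings K on N vertices
IsF : ℕ → ℕ → ℕ → ℕ → Set
IsF q r N m =
  (Σ (Coloring N q) λ c → IsFK c r m) ×
  (∀ (c : Coloring N q) m' → IsFK c r m' → m ≤ m')

{-# OPTIONS --safe #-}

-- Blow up an extremal colouring c₁ of Fin N₁ by an extremal colouring c₂ of Fin N₂:
-- split Fin (N₁ * N₂) lexicographically into N₁ consecutive blocks of size N₂, colour an
-- edge inside a block by c₂ and an edge between blocks by c₁.  A monotone path visits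
-- the blocks in increasing order, so the blocks it meets form a monotone path of c₁ and
-- each maximal stretch inside one block is a monotone path of c₂, all with colours from
-- the same set.  Hence the path meets at most a blocks with at most b vertices in each,
-- so f_{q,r}(N₁ N₂) ≤ f_{q,r}(K) ≤ a b for this blow-up K.

module Submission where

open import Defs
open import Data.Nat using (ℕ; zero; suc; _+_; _*_; _≤_; _<_; s≤s; s≤s⁻¹; z≤n; NonZero)
open import Data.Nat.Properties
  using (≤-refl; ≤-trans; ≤-reflexive; ≤∧≢⇒<; +-comm; +-suc; +-monoʳ-≤; *-monoˡ-≤;
         +-cancelˡ-<; suc-injective; anyUpTo?; module ≤-Reasoning)
open import Data.Fin as F using (Fin; combine; quotient; remainder)
import Data.Fin.Properties as FP
open import Data.List using (List; []; _∷_; length)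
open import Data.List.Relation.Unary.All using (All; all?; []; _∷_)
open import Data.List.Relation.Unary.Linked using (linked?; []; [-]; _∷_)
open import Data.List.Membership.Propositional using (_∈_)
import Data.List.Membership.DecPropositional as DecMembership
open import Data.Product using (∃; _×_; _,_; proj₁)
open import Data.Sum using (_⊎_; inj₁; inj₂)
open import Data.Empty using (⊥-elim)
open import Relation.Nullary using (Dec; yes; no)
open import Relation.Nullary.Decidable using (map′; _×-dec_)
open import Relation.Binary.Definitions using (tri<; tri≈; tri>)
open import Relation.Binary.PropositionalEquality using (_≡_; refl; sym; cong; subst₂)

module _ (P : ℕ → Set) (P? : ∀ k → Dec (P k)) (P0 : P 0) where

  bounded⇒∃greatest : ∀ B → (∀ k → P k → k ≤ B) → ∃ λ m → P m × (∀ k → P k → k ≤ m)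
  bounded⇒∃greatest zero    bounded = 0 , P0 , bounded
  bounded⇒∃greatest (suc B) bounded with P? (suc B)
  ... | yes PB = suc B , PB , bounded
  ... | no ¬PB = bounded⇒∃greatest B λ k Pk →
    s≤s⁻¹ (≤∧≢⇒< (bounded k Pk) λ { refl → ¬PB Pk })

module _ {n : ℕ} where

  ∃-length≡? : ∀ k (P : List (Fin n) → Set) → (∀ xs → Dec (P xs)) →
               Dec (∃ λ xs → length xs ≡ k × P xs)
  ∃-length≡? zero P P? = map′ (λ p → [] , refl , p) (λ { ([] , refl , p) → p }) (P? [])
  ∃-length≡? (suc k) P P? =
    map′ (λ { (x , xs , refl , p) → x ∷ xs , refl , p })
         (λ { (x ∷ xs , eq , p) → x , xs , suc-injective eq , p })
         (FP.any? λ x → ∃-length≡? k (λ xs → P (x ∷ xs)) (λ xs → P? (x ∷ xs)))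

  ∃-length≤? : ∀ r (P : List (Fin n) → Set) → (∀ xs → Dec (P xs)) →
               Dec (∃ λ xs → length xs ≤ r × P xs)
  ∃-length≤? r P P? =
    map′ (λ { (_ , s≤s k≤r , xs , refl , p) → xs , k≤r , p })
         (λ { (xs , l≤r , p) → length xs , s≤s l≤r , xs , refl , p })
         (anyUpTo? (λ k → ∃-length≡? k P P?) (suc r))

atMostColors? : ∀ {q} r (cs : List (Fin q)) → Dec (AtMostColors r cs)
atMostColors? {q} r cs = ∃-length≤? r (λ S → All (_∈ S) cs) (λ S → all? (_∈? S) cs)
  where open DecMembership (F._≟_ {q}) using (_∈?_)

hasPath? : ∀ {N q} (c : Coloring N q) r k → Dec (HasPath c r k)
hasPath? c r k = ∃-length≡? k _ λ P → linked? F._<?_ P ×-dec atMostColors? r (edgeColors c P)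

bounded⇒∃IsFK : ∀ {N q} (c : Coloring N q) r B → (∀ k → HasPath c r k → k ≤ B) → ∃ (IsFK c r)
bounded⇒∃IsFK c r =
  bounded⇒∃greatest (HasPath c r) (hasPath? c r) ([] , refl , [] , [] , z≤n , [])

MonotonePath : ∀ {N q} → Coloring N q → List (Fin q) → List (Fin N) → Set
MonotonePath c S P = Monotone P × All (_∈ S) (edgeColors c P)

IsFK⇒length≤ : ∀ {N q} {c : Coloring N q} {r m S} → IsFK c r m → length S ≤ r →
               ∀ {P} → MonotonePath c S P → length P ≤ m
IsFK⇒length≤ (_ , maximal) |S|≤r {P} (mono , cols) =
  maximal (length P) (P , refl , mono , _ , |S|≤r , cols)

combine-<-lex : ∀ {m n} {i j : Fin m} {k l : Fin n} → combine i k F.< combine j l →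
                i F.< j ⊎ (i ≡ j × k F.< l)
combine-<-lex {n = n} {i} {j} {k} {l} ik<jl with FP.<-cmp i j
... | tri< i<j _ _ = inj₁ i<j
... | tri> _ _ i>j = ⊥-elim (FP.<-asym ik<jl (FP.combine-monoˡ-< l k i>j))
... | tri≈ _ refl _ = inj₂ (refl , +-cancelˡ-< (n * F.toℕ i) _ _
        (subst₂ _<_ (FP.toℕ-combine i k) (FP.toℕ-combine i l) ik<jl))

quotient-remainder-<-lex : ∀ {m} n {x y : Fin (m * n)} → x F.< y →
  quotient {m} n x F.< quotient n y ⊎
  (quotient {m} n x ≡ quotient n y × remainder {m} n x F.< remainder {m} n y)
quotient-remainder-<-lex {m} n {x} {y} x<y = combine-<-lex
  (subst₂ F._<_ (sym (FP.combine-remQuot {m} n x)) (sym (FP.combine-remQuot {m} n y)) x<y)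

module LexProduct {M N₁ N₂ q : ℕ} (π₁ : Fin M → Fin N₁) (π₂ : Fin M → Fin N₂)
  (lex : ∀ {x y} → x F.< y → π₁ x F.< π₁ y ⊎ (π₁ x ≡ π₁ y × π₂ x F.< π₂ y))
  (c₁ : Coloring N₁ q) (c₂ : Coloring N₂ q) where

  product : Coloring M q
  product x y with π₁ x F.≟ π₁ y
  ... | yes _ = c₂ (π₂ x) (π₂ y)
  ... | no _  = c₁ (π₁ x) (π₁ y)

  blocksAfter : Fin M → List (Fin M) → List (Fin N₁)
  blocksAfter x [] = []
  blocksAfter x (y ∷ ys) with π₁ x F.≟ π₁ y
  ... | yes _ = blocksAfter y ys
  ... | no _  = π₁ y ∷ blocksAfter y ys

  runAfter : Fin M → List (Fin M) → List (Fin N₂)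
  runAfter x [] = []
  runAfter x (y ∷ ys) with π₁ x F.≟ π₁ y
  ... | yes _ = π₂ y ∷ runAfter y ys
  ... | no _  = []

  module _ {S : List (Fin q)} where

    blocks-path : ∀ x xs → MonotonePath product S (x ∷ xs) →
                  MonotonePath c₁ S (π₁ x ∷ blocksAfter x xs)
    blocks-path x []       _                      = [-] , []
    blocks-path x (y ∷ ys) (x<y ∷ mono , c ∷ cols) with π₁ x F.≟ π₁ y | lex x<y
    ... | yes x≡y  | _ rewrite x≡y   = blocks-path y ys (mono , cols)
    ... | no  x≢y  | inj₂ (x≡y , _)  = ⊥-elim (x≢y x≡y)
    ... | no  _    | inj₁ πx<πy      with blocks-path y ys (mono , cols)
    ...   | mono′ , cols′ = πx<πy ∷ mono′ , c ∷ cols′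

    run-path : ∀ x xs → MonotonePath product S (x ∷ xs) →
               MonotonePath c₂ S (π₂ x ∷ runAfter x xs)
    run-path x []       _                      = [-] , []
    run-path x (y ∷ ys) (x<y ∷ mono , c ∷ cols) with π₁ x F.≟ π₁ y | lex x<y
    ... | no  _    | _               = [-] , []
    ... | yes x≡y  | inj₁ πx<πy      = ⊥-elim (FP.<-irrefl x≡y πx<πy)
    ... | yes _    | inj₂ (_ , πx<πy) with run-path y ys (mono , cols)
    ...   | mono′ , cols′ = πx<πy ∷ mono′ , c ∷ cols′

    module _ {b : ℕ} (runs≤b : ∀ {P} → MonotonePath c₂ S P → length P ≤ b) where
      open ≤-Reasoning

      length≤blocks*b+run : ∀ x xs → MonotonePath product S (x ∷ xs) →
        length (x ∷ xs) ≤ length (blocksAfter x xs) * b + length (π₂ x ∷ runAfter x xs)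
      length≤blocks*b+run x [] _ = ≤-refl
      length≤blocks*b+run x (y ∷ ys) (_ ∷ mono , _ ∷ cols) with π₁ x F.≟ π₁ y
      ... | yes _ = ≤-trans (s≤s (length≤blocks*b+run y ys (mono , cols)))
                            (≤-reflexive (sym (+-suc _ _)))
      ... | no _ = begin
        suc (length (y ∷ ys))            ≤⟨ s≤s (length≤blocks*b+run y ys (mono , cols)) ⟩
        suc (t * b + length (π₂ y ∷ runAfter y ys))
                                         ≤⟨ s≤s (+-monoʳ-≤ (t * b) (runs≤b (run-path y ys (mono , cols)))) ⟩
        suc (t * b + b)                  ≡⟨ cong suc (+-comm (t * b) b) ⟩
        suc (suc t * b)                  ≡⟨ +-comm 1 _ ⟩
        suc t * b + 1                    ∎
        where t = length (blocksAfter y ys)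

    product-length≤ : ∀ {a b} → (∀ {P} → MonotonePath c₁ S P → length P ≤ a) →
                      (∀ {P} → MonotonePath c₂ S P → length P ≤ b) →
                      ∀ {P} → MonotonePath product S P → length P ≤ a * b
    product-length≤ _ _ {[]} _ = z≤n
    product-length≤ {a} {b} blocks≤a runs≤b {x ∷ xs} path = begin
      length (x ∷ xs)                       ≤⟨ length≤blocks*b+run runs≤b x xs path ⟩
      t * b + length (π₂ x ∷ runAfter x xs) ≤⟨ +-monoʳ-≤ (t * b) (runs≤b (run-path x xs path)) ⟩
      t * b + b                             ≡⟨ +-comm (t * b) b ⟩
      suc t * b                             ≤⟨ *-monoˡ-≤ b (blocks≤a (blocks-path x xs path)) ⟩
      a * b                                 ∎
      where
      open ≤-Reasoning
      t = length (blocksAfter x xs)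

corollary3p4 : (N₁ N₂ q r : ℕ) → .{{NonZero N₁}} → .{{NonZero N₂}} → .{{NonZero q}} → .{{NonZero r}} →
    (a b c : ℕ) → IsF q r N₁ a → IsF q r N₂ b → IsF q r (N₁ * N₂) c →
    c ≤ a * b
corollary3p4 N₁ N₂ q r a b c ((c₁ , c₁-fa) , _) ((c₂ , c₂-fb) , _) (_ , c-minimal) =
  let m , K-fm = bounded⇒∃IsFK K r (a * b) paths≤ab
  in  ≤-trans (c-minimal K m K-fm) (paths≤ab m (proj₁ K-fm))
  where
  open LexProduct (quotient {N₁} N₂) (remainder {N₁} N₂) (quotient-remainder-<-lex {N₁} N₂) c₁ c₂
  K : Coloring (N₁ * N₂) q
  K = product
  paths≤ab : ∀ k → HasPath K r k → k ≤ a * b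
  paths≤ab k (P , refl , mono , S , |S|≤r , cols) =
    product-length≤ (IsFK⇒length≤ c₁-fa |S|≤r) (IsFK⇒length≤ c₂-fb |S|≤r) (mono , cols)
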